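{- Let $n\ge3$, let $H$ be a finite abelian group of order $2n^2+1$ and let $T\subseteq H$ satisfy $|T|=2n$, $T=T^{(-1)}$ and $T^2=2H-T^{(2)}+(2n-2)e$ in $\mathbb{Z}[H]$. Write $TT^{(4)}=\sum_{i=0}^N iY_i$ in $\mathbb{Z}[H]$, where $Y_i$ is the set of elements of $H$ whose coefficient in $TT^{(4)}$ equals $i$ and $N$ is the largest coefficient (so $Y_0,\dots,Y_N$ partition $H$), and let $2\gamma=|T\cap T^{(4)}|$. Then (1) $\sum_{i=0}^N|Y_i|=2n^2+1$; (2) $\sum_{i=1}^N i|Y_i|=4n^2$; (3) $\sum_{i=1}^N|Y_i|=4n-\gamma+\sum_{i\ge3}\frac{(i-1)(i-2)}{2}|Y_i|$.
   Context: $H$ is written multiplicatively with identity $e$. In the group ring $\mathbb{Z}[H]$ a subset $A$ is identified with $\sum_{g\in A}g$ (so $H$ is the sum of all elements), and $A^{(t)}=\sum a_g g^t$ for $A=\sum a_g g$; $T^{(4)}=\{t^4:t\in T\}$. -}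

module Defs where

open import Data.Nat as ℕ using (ℕ; zero; suc)
open import Data.Integer as ℤ using (ℤ; +_; 0ℤ; 1ℤ)
open import Data.Bool using (Bool; true; false; if_then_else_)
open import Data.Fin using (Fin; zero; suc; _≟_)
open import Data.Fin.Subset using (Subset; _∈_)
open import Data.Fin.Subset.Properties using (_∈?_)
open import Data.Fin.Properties using (any?)
open import Data.Vec using (lookup; tabulate)
open import Data.Product using (_×_; _,_)
open import Relation.Nullary.Decidable using (⌊_⌋; _×-dec_)
open import Relation.Binary.PropositionalEquality using (_≡_)
open import Algebra.Core using (Op₁; Op₂)
open import Algebra.Structures using (IsAbelianGroup)

-- A finite abelian group of order m, with carrier Fin m (every finite abelian
-- group of order m is isomorphic to one of this form).
record FinAbGroup (m : ℕ) : Set where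
  infixl 7 _∙_
  field
    _∙_ : Op₂ (Fin m)
    ε   : Fin m
    _⁻¹ : Op₁ (Fin m)
    isAbelianGroup : IsAbelianGroup _≡_ _∙_ ε _⁻¹

-- Elements of the group ring ℤ[H]: coefficient functions.
GR : ℕ → Set
GR m = Fin m → ℤ

Σℤ : ∀ {m} → (Fin m → ℤ) → ℤ
Σℤ {zero}  f = 0ℤ
Σℤ {suc m} f = f zero ℤ.+ Σℤ (λ i → f (suc i))

⟦_⟧ : ∀ {m} → Subset m → GR m
⟦ S ⟧ g = if lookup S g then 1ℤ else 0ℤ

module _ {m : ℕ} (G : FinAbGroup m) where
  open FinAbGroup G

  mul : GR m → GR m → GR m
  mul A B g = Σℤ (λ h → A h ℤ.* B (h ⁻¹ ∙ g))

  pow : ℕ → Fin m → Fin m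
  pow zero    g = ε
  pow (suc k) g = g ∙ pow k g

  zpow : ℤ → Fin m → Fin m
  zpow (+ k)      g = pow k g
  zpow ℤ.-[1+ k ] g = (pow (suc k) g) ⁻¹

  dil : ℤ → GR m → GR m
  dil t A g = Σℤ (λ h → if ⌊ zpow t h ≟ g ⌋ then A h else 0ℤ)

  Hall : GR m
  Hall _ = 1ℤ

  eGR : GR m
  eGR g = if ⌊ g ≟ ε ⌋ then 1ℤ else 0ℤ

  set4 : Subset m → Subset m
  set4 T = tabulate (λ g → ⌊ any? (λ h → (h ∈? T) ×-dec (pow 4 h ≟ g)) ⌋)

Ylevel : ∀ {m} → GR m → ℕ → Subset m
Ylevel C i = tabulate (λ g → ⌊ C g ℤ.≟ + i ⌋)

{-# OPTIONS --safe #-}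
-- The coefficients c_g of C = T T^(4) are natural numbers, and the sums in (1)-(3) are Σ_g w(c_g)
-- for w(x) = 1, x, [x > 0] and (x-1)(x-2)/2. So everything follows from the two moments
-- Σ c_g = |T| |T^(4)| = 4n² and Σ c_g², using 2[x > 0] + x² = 3x + (x-1)(x-2).
-- For the second moment, Σ_g (AB)(g)² = Σ_x (A^(-1)A)(x) (B^(-1)B)(x). As |H| is odd, squaring is an
-- automorphism, T^(4) is T composed with the inverse of x ↦ x⁴, and T^(-1)T = T² = 2H - T^(2) + (2n-2)e.
-- Substituting x = y² the sum becomes Σ_y (2 - T(y) + (2n-2)[y = e]) (2 - T^(4)(y) + (2n-2)[y = e]),
-- which is 12n² - 8n + 2γ because e ∉ T, as |T| = (T^(-1)T)(e) shows.
module Submission where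

open import Defs
open import Data.Nat as ℕ using (ℕ; zero; suc; _+_; _*_; _∸_; _≤_; _<_; _/_; _<?_; _<ᵇ_; s≤s; z≤n)
import Data.Nat.Properties as ℕP
import Data.Nat.Tactic.RingSolver as ℕSolver
open import Data.Nat.Divisibility using (_∣_; _∣0; ∣m∣n⇒∣m+n; m∣m*n)
open import Data.Nat.DivMod using (m*[n/m]≡n)
open import Data.Nat.ListAction using (sum)
open import Data.Nat.ListAction.Properties using (sum-++)
open import Data.Integer as ℤ using (ℤ; +_; 0ℤ; 1ℤ)
import Data.Integer.Properties as ℤP
open import Data.Integer.Tactic.RingSolver using (solve-∀)
open import Data.Bool using (Bool; true; false; if_then_else_; _∧_)
open import Data.Fin using (Fin; zero; suc; _≟_)
import Data.Fin.Properties as FP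
open import Data.Fin.Properties using (any?)
open import Data.Fin.Permutation using (Permutation′; permutation; _⟨$⟩ʳ_; _⟨$⟩ˡ_; _∘ₚ_; flip; inverseˡ; inverseʳ)
open import Data.Fin.Subset using (Subset; ∣_∣; _∩_; _∈_; inside; outside)
open import Data.Fin.Subset.Properties using (_∈?_)
open import Data.Vec using ([]; _∷_; lookup)
open import Data.Vec.Properties using (lookup∘tabulate; lookup-zipWith)
open import Data.List using ([_]; _∷ʳ_; _++_; map; upTo; applyUpTo)
open import Data.List.Properties using (upTo-∷ʳ; map-++; map-cong; map-upTo; map-applyUpTo)
open import Data.Product using (_×_; ∃; _,_)
open import Function using (_∘_; _⇔_; mk⇔)
open import Relation.Binary.Definitions using (tri<; tri≈; tri>)
open import Relation.Binary.PropositionalEquality using (_≡_; refl; sym; trans; cong; cong₂; subst; module ≡-Reasoning)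
open import Relation.Nullary using (Dec; yes; no; ¬_; contradiction)
open import Relation.Nullary.Decidable using (⌊_⌋; isYes≗does; does-⇔; ⌊⌋-map′; _×-dec_)
open import Algebra.Bundles using (AbelianGroup)
open import Algebra.Structures using (IsAbelianGroup)
import Algebra.Properties.Group as GroupProperties
import Algebra.Properties.Monoid.Mult as MonoidMult
import Algebra.Properties.CommutativeMonoid.Mult as CommutativeMonoidMult
import Algebra.Properties.CommutativeMonoid.Sum as CommutativeMonoidSum
import Algebra.Properties.Semiring.Sum as SemiringSum
open import Algebra.Properties.CommutativeSemigroup ℤP.*-commutativeSemigroup using (interchange)

module ℤΣ = SemiringSum ℤP.+-*-semiring
module ℕΣ = SemiringSum ℕP.+-*-semiring

-- Finite sums over Fin m

Σℤ≡sum : ∀ {m} (f : Fin m → ℤ) → Σℤ f ≡ ℤΣ.sum f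
Σℤ≡sum {zero}  f = refl
Σℤ≡sum {suc m} f = cong (ℤ._+_ (f zero)) (Σℤ≡sum (f ∘ suc))

Σℤ-cong : ∀ {m} {f g : Fin m → ℤ} → (∀ i → f i ≡ g i) → Σℤ f ≡ Σℤ g
Σℤ-cong {zero}  f≗g = refl
Σℤ-cong {suc m} f≗g = cong₂ ℤ._+_ (f≗g zero) (Σℤ-cong (f≗g ∘ suc))

Σℤ-const : ∀ {m} (c : ℤ) → Σℤ {m} (λ _ → c) ≡ + m ℤ.* c
Σℤ-const {zero}  c = sym (ℤP.*-zeroˡ c)
Σℤ-const {suc m} c = begin
  c ℤ.+ Σℤ {m} (λ _ → c)  ≡⟨ cong (ℤ._+_ c) (Σℤ-const {m} c) ⟩
  c ℤ.+ + m ℤ.* c         ≡⟨ ℤP.suc-* (+ m) c ⟨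
  ℤ.suc (+ m) ℤ.* c       ∎
  where open ≡-Reasoning

Σℤ-δ : ∀ {m} (a : Fin m) (f : Fin m → ℤ) → Σℤ (λ i → if ⌊ i ≟ a ⌋ then f i else 0ℤ) ≡ f a
Σℤ-δ {suc m} zero    f = begin
  f zero ℤ.+ Σℤ {m} (λ _ → 0ℤ)  ≡⟨ cong (ℤ._+_ (f zero)) (trans (Σℤ-const {m} 0ℤ) (ℤP.*-zeroʳ (+ m))) ⟩
  f zero ℤ.+ 0ℤ                 ≡⟨ ℤP.+-identityʳ (f zero) ⟩
  f zero                        ∎
  where open ≡-Reasoning
Σℤ-δ {suc m} (suc a) f =
  trans (ℤP.+-identityˡ _) (trans (Σℤ-cong suc≟suc) (Σℤ-δ a (f ∘ suc)))
  where
  suc≟suc : ∀ i → (if ⌊ suc i ≟ suc a ⌋ then f (suc i) else 0ℤ) ≡ (if ⌊ i ≟ a ⌋ then f (suc i) else 0ℤ)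
  suc≟suc i = cong (λ b → if b then f (suc i) else 0ℤ) (⌊⌋-map′ (cong suc) FP.suc-injective (i ≟ a))

Σℤ-pos : ∀ {m} (f : Fin m → ℕ) → Σℤ (λ i → + f i) ≡ + ℕΣ.sum f
Σℤ-pos {zero}  f = refl
Σℤ-pos {suc m} f = trans (cong (ℤ._+_ (+ f zero)) (Σℤ-pos (f ∘ suc))) (sym (ℤP.pos-+ (f zero) _))

module _ {m : ℕ} where

  Σℤ-+ : (f g : Fin m → ℤ) → Σℤ (λ i → f i ℤ.+ g i) ≡ Σℤ f ℤ.+ Σℤ g
  Σℤ-+ f g = begin
    Σℤ (λ i → f i ℤ.+ g i)      ≡⟨ Σℤ≡sum (λ i → f i ℤ.+ g i) ⟩
    ℤΣ.sum (λ i → f i ℤ.+ g i)  ≡⟨ ℤΣ.∑-distrib-+ f g ⟩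
    ℤΣ.sum f ℤ.+ ℤΣ.sum g       ≡⟨ cong₂ ℤ._+_ (Σℤ≡sum f) (Σℤ≡sum g) ⟨
    Σℤ f ℤ.+ Σℤ g               ∎
    where open ≡-Reasoning

  Σℤ-*ˡ : (c : ℤ) (f : Fin m → ℤ) → Σℤ (λ i → c ℤ.* f i) ≡ c ℤ.* Σℤ f
  Σℤ-*ˡ c f = begin
    Σℤ (λ i → c ℤ.* f i)     ≡⟨ Σℤ≡sum (λ i → c ℤ.* f i) ⟩
    ℤΣ.sum (λ i → c ℤ.* f i) ≡⟨ ℤΣ.*-distribˡ-sum c f ⟨
    c ℤ.* ℤΣ.sum f           ≡⟨ cong (ℤ._*_ c) (Σℤ≡sum f) ⟨
    c ℤ.* Σℤ f               ∎
    where open ≡-Reasoning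

  Σℤ-*ʳ : (c : ℤ) (f : Fin m → ℤ) → Σℤ (λ i → f i ℤ.* c) ≡ Σℤ f ℤ.* c
  Σℤ-*ʳ c f = trans (Σℤ-cong (λ i → ℤP.*-comm (f i) c)) (trans (Σℤ-*ˡ c f) (ℤP.*-comm c _))

  Σℤ-permute : (π : Permutation′ m) (f : Fin m → ℤ) → Σℤ f ≡ Σℤ (λ i → f (π ⟨$⟩ʳ i))
  Σℤ-permute π f = begin
    Σℤ f                         ≡⟨ Σℤ≡sum f ⟩
    ℤΣ.sum f                     ≡⟨ ℤΣ.∑-permute f π ⟩
    ℤΣ.sum (λ i → f (π ⟨$⟩ʳ i))  ≡⟨ Σℤ≡sum (λ i → f (π ⟨$⟩ʳ i)) ⟨
    Σℤ (λ i → f (π ⟨$⟩ʳ i))      ∎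
    where open ≡-Reasoning

Σℤ-comm : ∀ {m k} (f : Fin m → Fin k → ℤ) →
          Σℤ (λ i → Σℤ (λ j → f i j)) ≡ Σℤ (λ j → Σℤ (λ i → f i j))
Σℤ-comm f = begin
  Σℤ (λ i → Σℤ (f i))                  ≡⟨ Σℤ-cong (λ i → Σℤ≡sum (f i)) ⟩
  Σℤ (λ i → ℤΣ.sum (f i))              ≡⟨ Σℤ≡sum (λ i → ℤΣ.sum (f i)) ⟩
  ℤΣ.sum (λ i → ℤΣ.sum (f i))          ≡⟨ ℤΣ.∑-comm f ⟩
  ℤΣ.sum (λ j → ℤΣ.sum (λ i → f i j))  ≡⟨ Σℤ≡sum (λ j → ℤΣ.sum (λ i → f i j)) ⟨
  Σℤ (λ j → ℤΣ.sum (λ i → f i j))      ≡⟨ Σℤ-cong (λ j → Σℤ≡sum (λ i → f i j)) ⟨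
  Σℤ (λ j → Σℤ (λ i → f i j))          ∎
  where open ≡-Reasoning

Σℤ-*-Σℤ : ∀ {m k} (f : Fin m → ℤ) (g : Fin k → ℤ) →
          Σℤ f ℤ.* Σℤ g ≡ Σℤ (λ i → Σℤ (λ j → f i ℤ.* g j))
Σℤ-*-Σℤ f g = begin
  Σℤ f ℤ.* Σℤ g                      ≡⟨ Σℤ-*ʳ (Σℤ g) f ⟨
  Σℤ (λ i → f i ℤ.* Σℤ g)            ≡⟨ Σℤ-cong (λ i → Σℤ-*ˡ (f i) g) ⟨
  Σℤ (λ i → Σℤ (λ j → f i ℤ.* g j))  ∎
  where open ≡-Reasoning

𝟙 : Bool → ℕ
𝟙 b = if b then 1 else 0

𝟙-yes : ∀ {P : Set} (p? : Dec P) → P → 𝟙 ⌊ p? ⌋ ≡ 1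
𝟙-yes (yes _) _ = refl
𝟙-yes (no ¬p) p = contradiction p ¬p

𝟙-no : ∀ {P : Set} (p? : Dec P) → ¬ P → 𝟙 ⌊ p? ⌋ ≡ 0
𝟙-no (yes p) ¬p = contradiction p ¬p
𝟙-no (no _)  _  = refl

∣∣≡Σ𝟙 : ∀ {m} (S : Subset m) → ∣ S ∣ ≡ ℕΣ.sum (λ i → 𝟙 (lookup S i))
∣∣≡Σ𝟙 []          = refl
∣∣≡Σ𝟙 (true  ∷ S) = cong suc (∣∣≡Σ𝟙 S)
∣∣≡Σ𝟙 (false ∷ S) = ∣∣≡Σ𝟙 S

ℕΣ-const : ∀ {m} (k : ℕ) → ℕΣ.sum {m} (λ _ → k) ≡ m * k
ℕΣ-const {zero}  k = refl
ℕΣ-const {suc m} k = cong (_+_ k) (ℕΣ-const {m} k)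

⟦⟧≡𝟙 : ∀ {m} (S : Subset m) g → ⟦ S ⟧ g ≡ + 𝟙 (lookup S g)
⟦⟧≡𝟙 S g with lookup S g
... | true  = refl
... | false = refl

⟦⟧-idem : ∀ {m} (S : Subset m) g → ⟦ S ⟧ g ℤ.* ⟦ S ⟧ g ≡ ⟦ S ⟧ g
⟦⟧-idem S g with lookup S g
... | true  = refl
... | false = refl

⟦∩⟧ : ∀ {m} (S S′ : Subset m) g → ⟦ S ∩ S′ ⟧ g ≡ ⟦ S ⟧ g ℤ.* ⟦ S′ ⟧ g
⟦∩⟧ S S′ g rewrite lookup-zipWith _∧_ g S S′ with lookup S g | lookup S′ g
... | true  | true  = refl
... | true  | false = refl
... | false | _     = refl

Σℤ-⟦⟧ : ∀ {m} (S : Subset m) → Σℤ ⟦ S ⟧ ≡ + ∣ S ∣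
Σℤ-⟦⟧ S = trans (Σℤ-cong (⟦⟧≡𝟙 S)) (trans (Σℤ-pos (λ g → 𝟙 (lookup S g))) (cong (λ k → + k) (sym (∣∣≡Σ𝟙 S))))

⌊⌋-⇔ : ∀ {P Q : Set} → P ⇔ Q → (p? : Dec P) (q? : Dec Q) → ⌊ p? ⌋ ≡ ⌊ q? ⌋
⌊⌋-⇔ P⇔Q p? q? = trans (isYes≗does p?) (trans (does-⇔ P⇔Q p? q?) (sym (isYes≗does q?)))

⌊∈?⌋ : ∀ {m} (x : Fin m) (S : Subset m) → ⌊ x ∈? S ⌋ ≡ lookup S x
⌊∈?⌋ zero    (inside  ∷ S) = refl
⌊∈?⌋ zero    (outside ∷ S) = refl
⌊∈?⌋ (suc x) (_ ∷ S)       = trans (⌊⌋-map′ _ _ (x ∈? S)) (⌊∈?⌋ x S)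

-- Sums over the level sets of a coefficient function

sum-upTo-suc : ∀ (f : ℕ → ℕ) K → sum (map f (upTo (suc K))) ≡ sum (map f (upTo K)) + f K
sum-upTo-suc f K = begin
  sum (map f (upTo (suc K)))          ≡⟨ cong (sum ∘ map f) (upTo-∷ʳ K) ⟨
  sum (map f (upTo K ∷ʳ K))           ≡⟨ cong sum (map-++ f (upTo K) [ K ]) ⟩
  sum (map f (upTo K) ++ [ f K ])     ≡⟨ sum-++ (map f (upTo K)) [ f K ] ⟩
  sum (map f (upTo K)) + (f K + 0)    ≡⟨ cong (_+_ (sum (map f (upTo K)))) (ℕP.+-identityʳ (f K)) ⟩
  sum (map f (upTo K)) + f K          ∎
  where open ≡-Reasoning

sum-upTo-offset : ∀ (f : ℕ → ℕ) o K → (∀ i → i < o → f i ≡ 0) →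
                  sum (map (λ j → f (j + o)) (upTo K)) ≡ sum (map f (upTo (K + o)))
sum-upTo-offset f zero K _ = begin
  sum (map (λ j → f (j + 0)) (upTo K)) ≡⟨ cong sum (map-cong (λ j → cong f (ℕP.+-identityʳ j)) (upTo K)) ⟩
  sum (map f (upTo K))                 ≡⟨ cong (sum ∘ map f ∘ upTo) (ℕP.+-identityʳ K) ⟨
  sum (map f (upTo (K + 0)))           ∎
  where open ≡-Reasoning
sum-upTo-offset f (suc o) K f<o≡0 = begin
  sum (map (λ j → f (j + suc o)) (upTo K))
    ≡⟨ cong sum (map-cong (λ j → cong f (ℕP.+-suc j o)) (upTo K)) ⟩
  sum (map (λ j → f (suc (j + o))) (upTo K))
    ≡⟨ sum-upTo-offset (f ∘ suc) o K (λ i i<o → f<o≡0 (suc i) (s≤s i<o)) ⟩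
  sum (map (f ∘ suc) (upTo (K + o)))
    ≡⟨ cong sum (trans (map-upTo (f ∘ suc) (K + o)) (sym (map-applyUpTo suc f (K + o)))) ⟩
  sum (map f (applyUpTo suc (K + o)))
    ≡⟨ cong (_+ sum (map f (applyUpTo suc (K + o)))) (f<o≡0 0 (s≤s z≤n)) ⟨
  sum (map f (upTo (suc (K + o))))
    ≡⟨ cong (sum ∘ map f ∘ upTo) (ℕP.+-suc K o) ⟨
  sum (map f (upTo (K + suc o)))
    ∎
  where open ≡-Reasoning

module _ {m} (C : Fin m → ℤ) (c : Fin m → ℕ) (C≡c : ∀ g → C g ≡ + c g) where

  lookup-Ylevel : ∀ i g → lookup (Ylevel C i) g ≡ ⌊ c g ℕ.≟ i ⌋
  lookup-Ylevel i g = begin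
    lookup (Ylevel C i) g  ≡⟨ lookup∘tabulate (λ h → ⌊ C h ℤ.≟ + i ⌋) g ⟩
    ⌊ C g ℤ.≟ + i ⌋        ≡⟨ cong (λ z → ⌊ z ℤ.≟ + i ⌋) (C≡c g) ⟩
    ⌊ + c g ℤ.≟ + i ⌋      ≡⟨ ⌊⌋-map′ (cong (λ n → + n)) ℤP.+-injective (c g ℕ.≟ i) ⟩
    ⌊ c g ℕ.≟ i ⌋          ∎
    where open ≡-Reasoning

  𝟙<suc-split : ∀ (w : ℕ → ℕ) K x →
                𝟙 ⌊ x <? suc K ⌋ * w x ≡ 𝟙 ⌊ x <? K ⌋ * w x + w K * 𝟙 ⌊ x ℕ.≟ K ⌋
  𝟙<suc-split w K x with ℕP.<-cmp x K
  ... | tri< x<K x≢K _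
    rewrite 𝟙-yes (x <? suc K) (ℕP.m<n⇒m<1+n x<K) | 𝟙-yes (x <? K) x<K | 𝟙-no (x ℕ.≟ K) x≢K
    = sym (trans (cong (_+_ (w x + 0)) (ℕP.*-zeroʳ (w K))) (ℕP.+-identityʳ _))
  ... | tri≈ _ refl _
    rewrite 𝟙-yes (x <? suc x) (ℕP.n<1+n x) | 𝟙-no (x <? x) (ℕP.<-irrefl refl) | 𝟙-yes (x ℕ.≟ x) refl
    = trans (ℕP.+-identityʳ (w x)) (sym (ℕP.*-identityʳ (w x)))
  ... | tri> _ x≢K K<x
    rewrite 𝟙-no (x <? suc K) (ℕP.<⇒≱ K<x ∘ ℕP.m<1+n⇒m≤n) | 𝟙-no (x <? K) (ℕP.<-asym K<x) | 𝟙-no (x ℕ.≟ K) x≢K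
    = sym (ℕP.*-zeroʳ (w K))

  *∣Ylevel∣≡Σ : ∀ k i → k * ∣ Ylevel C i ∣ ≡ ℕΣ.sum (λ g → k * 𝟙 ⌊ c g ℕ.≟ i ⌋)
  *∣Ylevel∣≡Σ k i = begin
    k * ∣ Ylevel C i ∣
      ≡⟨ cong (_*_ k) (∣∣≡Σ𝟙 (Ylevel C i)) ⟩
    k * ℕΣ.sum (λ g → 𝟙 (lookup (Ylevel C i) g))
      ≡⟨ cong (_*_ k) (ℕΣ.sum-cong-≗ (cong 𝟙 ∘ lookup-Ylevel i)) ⟩
    k * ℕΣ.sum (λ g → 𝟙 ⌊ c g ℕ.≟ i ⌋)
      ≡⟨ ℕΣ.*-distribˡ-sum k (λ g → 𝟙 ⌊ c g ℕ.≟ i ⌋) ⟩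
    ℕΣ.sum (λ g → k * 𝟙 ⌊ c g ℕ.≟ i ⌋)
      ∎
    where open ≡-Reasoning

  sum-levels-below : ∀ (w : ℕ → ℕ) K →
    sum (map (λ i → w i * ∣ Ylevel C i ∣) (upTo K)) ≡ ℕΣ.sum (λ g → 𝟙 ⌊ c g <? K ⌋ * w (c g))
  sum-levels-below w zero =
    sym (trans (ℕΣ.sum-cong-≗ (λ g → cong (λ b → b * w (c g)) (𝟙-no (c g <? 0) λ ()))) (ℕΣ.sum-replicate-zero m))
  sum-levels-below w (suc K) = begin
    sum (map F (upTo (suc K)))
      ≡⟨ sum-upTo-suc F K ⟩
    sum (map F (upTo K)) + w K * ∣ Ylevel C K ∣
      ≡⟨ cong₂ _+_ (sum-levels-below w K) (*∣Ylevel∣≡Σ (w K) K) ⟩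
    ℕΣ.sum (λ g → 𝟙 ⌊ c g <? K ⌋ * w (c g)) + ℕΣ.sum (λ g → w K * 𝟙 ⌊ c g ℕ.≟ K ⌋)
      ≡⟨ ℕΣ.∑-distrib-+ (λ g → 𝟙 ⌊ c g <? K ⌋ * w (c g)) (λ g → w K * 𝟙 ⌊ c g ℕ.≟ K ⌋) ⟨
    ℕΣ.sum (λ g → 𝟙 ⌊ c g <? K ⌋ * w (c g) + w K * 𝟙 ⌊ c g ℕ.≟ K ⌋)
      ≡⟨ ℕΣ.sum-cong-≗ (λ g → 𝟙<suc-split w K (c g)) ⟨
    ℕΣ.sum (λ g → 𝟙 ⌊ c g <? suc K ⌋ * w (c g))
      ∎
    where
    open ≡-Reasoning
    F : ℕ → ℕ
    F i = w i * ∣ Ylevel C i ∣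

  sum-levels : ∀ (w : ℕ → ℕ) K → (∀ g → c g < K) →
               sum (map (λ i → w i * ∣ Ylevel C i ∣) (upTo K)) ≡ ℕΣ.sum (λ g → w (c g))
  sum-levels w K c<K = trans (sum-levels-below w K)
    (ℕΣ.sum-cong-≗ λ g → trans (cong (λ b → b * w (c g)) (𝟙-yes (c g <? K) (c<K g))) (ℕP.+-identityʳ (w (c g))))

-- Finite abelian groups and their group rings

module _ {m : ℕ} (G : FinAbGroup m) where
  open FinAbGroup G
  private
    abelianGroup : AbelianGroup _ _
    abelianGroup = record { isAbelianGroup = isAbelianGroup }
    open AbelianGroup abelianGroup using (group; commutativeMonoid; assoc; comm; identityˡ; identityʳ)
    open GroupProperties group using (⁻¹-involutive; \\-leftDividesˡ; \\-leftDividesʳ; identityˡ-unique; identityʳ-unique)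
    open MonoidMult (AbelianGroup.monoid abelianGroup) using (×-assocˡ) renaming (_×_ to _×ᵐ_)
    open CommutativeMonoidMult commutativeMonoid using (×-distrib-+)
    module ΣG = CommutativeMonoidSum commutativeMonoid

  Homomorphic : (Fin m → Fin m) → Set
  Homomorphic f = ∀ x y → f (x ∙ y) ≡ f x ∙ f y

  translation : Fin m → Permutation′ m
  translation h = permutation (h ∙_) (h ⁻¹ ∙_) (\\-leftDividesˡ h) (\\-leftDividesʳ h)

  inversion : Permutation′ m
  inversion = permutation _⁻¹ _⁻¹ ⁻¹-involutive ⁻¹-involutive

  pow≗×ᵐ : ∀ k g → pow G k g ≡ k ×ᵐ g
  pow≗×ᵐ zero    g = refl
  pow≗×ᵐ (suc k) g = cong (g ∙_) (pow≗×ᵐ k g)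

  pow-∙ : ∀ k → Homomorphic (pow G k)
  pow-∙ k x y = begin
    pow G k (x ∙ y)          ≡⟨ pow≗×ᵐ k (x ∙ y) ⟩
    k ×ᵐ (x ∙ y)              ≡⟨ ×-distrib-+ x y k ⟩
    k ×ᵐ x ∙ k ×ᵐ y            ≡⟨ cong₂ _∙_ (pow≗×ᵐ k x) (pow≗×ᵐ k y) ⟨
    pow G k x ∙ pow G k y    ∎
    where open ≡-Reasoning

  pow-pow : ∀ a b g → pow G a (pow G b g) ≡ pow G (a * b) g
  pow-pow a b g = begin
    pow G a (pow G b g)  ≡⟨ trans (pow≗×ᵐ a _) (cong (a ×ᵐ_) (pow≗×ᵐ b g)) ⟩
    a ×ᵐ (b ×ᵐ g)          ≡⟨ ×-assocˡ g a b ⟩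
    (a * b) ×ᵐ g          ≡⟨ pow≗×ᵐ (a * b) g ⟨
    pow G (a * b) g      ∎
    where open ≡-Reasoning

  -- Translating by z permutes the group, so z^m multiplies the product of all elements into itself.
  pow-order : ∀ z → pow G m z ≡ ε
  pow-order z = trans (pow≗×ᵐ m z) (identityˡ-unique (m ×ᵐ z) Π (sym Π≡z^mΠ))
    where
    Π = ΣG.sum (λ h → h)
    Π≡z^mΠ : Π ≡ m ×ᵐ z ∙ Π
    Π≡z^mΠ = trans (ΣG.∑-permute (λ h → h) (translation z))
                   (trans (ΣG.∑-distrib-+ (λ _ → z) (λ h → h)) (cong (_∙ Π) (ΣG.sum-replicate m)))

  pow-permutation : ∀ a b q → a * b ≡ suc (q * m) → Permutation′ m
  pow-permutation a b q ab≡1 =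
    permutation (pow G a) (pow G b) (cancel a b ab≡1) (cancel b a (trans (ℕP.*-comm b a) ab≡1))
    where
    cancel : ∀ a b → a * b ≡ suc (q * m) → ∀ g → pow G a (pow G b g) ≡ g
    cancel a b ab≡1 g = begin
      pow G a (pow G b g)       ≡⟨ pow-pow a b g ⟩
      pow G (a * b) g           ≡⟨ cong (λ k → pow G k g) ab≡1 ⟩
      g ∙ pow G (q * m) g       ≡⟨ cong (λ k → g ∙ pow G k g) (ℕP.*-comm q m) ⟩
      g ∙ pow G (m * q) g       ≡⟨ cong (g ∙_) (sym (pow-pow m q g)) ⟩
      g ∙ pow G m (pow G q g)   ≡⟨ cong (g ∙_) (pow-order (pow G q g)) ⟩
      g ∙ ε                     ≡⟨ identityʳ g ⟩
      g                         ∎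
      where open ≡-Reasoning

  hom-ε : ∀ {f} → Homomorphic f → f ε ≡ ε
  hom-ε {f} f-hom = identityʳ-unique (f ε) (f ε) (trans (sym (f-hom ε ε)) (cong f (identityˡ ε)))

  eGR-automorphism : (π : Permutation′ m) → Homomorphic (π ⟨$⟩ʳ_) → ∀ y → eGR G (π ⟨$⟩ʳ y) ≡ eGR G y
  eGR-automorphism π π-hom y = cong (λ b → if b then 1ℤ else 0ℤ) (⌊⌋-⇔ (mk⇔ to from) (π ⟨$⟩ʳ y ≟ ε) (y ≟ ε))
    where
    to : π ⟨$⟩ʳ y ≡ ε → y ≡ ε
    to πy≡ε = trans (sym (inverseˡ π)) (trans (cong (π ⟨$⟩ˡ_) (trans πy≡ε (sym (hom-ε π-hom)))) (inverseˡ π))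
    from : y ≡ ε → π ⟨$⟩ʳ y ≡ ε
    from y≡ε = trans (cong (π ⟨$⟩ʳ_) y≡ε) (hom-ε π-hom)

  dil-permutation : ∀ k (π : Permutation′ m) → (∀ h → π ⟨$⟩ʳ h ≡ zpow G k h) →
                    ∀ A g → dil G k A g ≡ A (π ⟨$⟩ˡ g)
  dil-permutation k π π≗zpow A g = trans (Σℤ-cong select) (Σℤ-δ (π ⟨$⟩ˡ g) A)
    where
    select : ∀ h → (if ⌊ zpow G k h ≟ g ⌋ then A h else 0ℤ) ≡ (if ⌊ h ≟ π ⟨$⟩ˡ g ⌋ then A h else 0ℤ)
    select h = cong (λ b → if b then A h else 0ℤ) (⌊⌋-⇔ (mk⇔ to from) (zpow G k h ≟ g) (h ≟ π ⟨$⟩ˡ g))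
      where
      to : zpow G k h ≡ g → h ≡ π ⟨$⟩ˡ g
      to e = trans (sym (inverseˡ π)) (cong (π ⟨$⟩ˡ_) (trans (π≗zpow h) e))
      from : h ≡ π ⟨$⟩ˡ g → zpow G k h ≡ g
      from e = trans (sym (π≗zpow h)) (trans (cong (π ⟨$⟩ʳ_) e) (inverseʳ π))

  ⟦set4⟧ : (π : Permutation′ m) → (∀ h → π ⟨$⟩ʳ h ≡ pow G 4 h) →
           ∀ T y → ⟦ set4 G T ⟧ y ≡ ⟦ T ⟧ (π ⟨$⟩ˡ y)
  ⟦set4⟧ π π≗pow4 T y = cong (λ b → if b then 1ℤ else 0ℤ) (begin
    lookup (set4 G T) y
      ≡⟨ lookup∘tabulate _ y ⟩
    ⌊ any? (λ h → (h ∈? T) ×-dec (pow G 4 h ≟ y)) ⌋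
      ≡⟨ ⌊⌋-⇔ (mk⇔ to from) (any? (λ h → (h ∈? T) ×-dec (pow G 4 h ≟ y))) (π ⟨$⟩ˡ y ∈? T) ⟩
    ⌊ π ⟨$⟩ˡ y ∈? T ⌋
      ≡⟨ ⌊∈?⌋ (π ⟨$⟩ˡ y) T ⟩
    lookup T (π ⟨$⟩ˡ y)
      ∎)
    where
    open ≡-Reasoning
    to : (∃ λ h → h ∈ T × pow G 4 h ≡ y) → π ⟨$⟩ˡ y ∈ T
    to (h , h∈T , e) = subst (_∈ T) (trans (sym (inverseˡ π)) (cong (π ⟨$⟩ˡ_) (trans (π≗pow4 h) e))) h∈T
    from : π ⟨$⟩ˡ y ∈ T → ∃ λ h → h ∈ T × pow G 4 h ≡ y
    from mem = π ⟨$⟩ˡ y , mem , trans (sym (π≗pow4 _)) (inverseʳ π)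

  -- autocorr A x is the coefficient of x in A^(-1) A.
  autocorr : GR m → GR m
  autocorr A x = Σℤ (λ h → A h ℤ.* A (x ∙ h))

  autocorr-automorphism : (π : Permutation′ m) → Homomorphic (π ⟨$⟩ʳ_) →
                          ∀ A x → autocorr (λ h → A (π ⟨$⟩ʳ h)) x ≡ autocorr A (π ⟨$⟩ʳ x)
  autocorr-automorphism π π-hom A x =
    trans (Σℤ-cong (λ h → cong (λ z → A (π ⟨$⟩ʳ h) ℤ.* A z) (π-hom x h)))
          (sym (Σℤ-permute π (λ k → A k ℤ.* A ((π ⟨$⟩ʳ x) ∙ k))))

  mul-self : ∀ A → (∀ h → A (h ⁻¹) ≡ A h) → ∀ x → mul G A A x ≡ autocorr A x
  mul-self A A-sym x = begin
    Σℤ (λ h → A h ℤ.* A (h ⁻¹ ∙ x))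
      ≡⟨ Σℤ-permute inversion (λ h → A h ℤ.* A (h ⁻¹ ∙ x)) ⟩
    Σℤ (λ h → A (h ⁻¹) ℤ.* A (h ⁻¹ ⁻¹ ∙ x))
      ≡⟨ Σℤ-cong (λ h → cong₂ ℤ._*_ (A-sym h) (cong A (trans (cong (_∙ x) (⁻¹-involutive h)) (comm h x)))) ⟩
    autocorr A x
      ∎
    where open ≡-Reasoning

  Σℤ-mul : ∀ A B → Σℤ (mul G A B) ≡ Σℤ A ℤ.* Σℤ B
  Σℤ-mul A B = begin
    Σℤ (λ g → Σℤ (λ h → A h ℤ.* B (h ⁻¹ ∙ g)))
      ≡⟨ Σℤ-comm (λ g h → A h ℤ.* B (h ⁻¹ ∙ g)) ⟩
    Σℤ (λ h → Σℤ (λ g → A h ℤ.* B (h ⁻¹ ∙ g)))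
      ≡⟨ Σℤ-cong (λ h → Σℤ-*ˡ (A h) (λ g → B (h ⁻¹ ∙ g))) ⟩
    Σℤ (λ h → A h ℤ.* Σℤ (λ g → B (h ⁻¹ ∙ g)))
      ≡⟨ Σℤ-cong (λ h → cong (ℤ._*_ (A h)) (Σℤ-permute (translation (h ⁻¹)) B)) ⟨
    Σℤ (λ h → A h ℤ.* Σℤ B)
      ≡⟨ Σℤ-*ʳ (Σℤ B) A ⟩
    Σℤ A ℤ.* Σℤ B
      ∎
    where open ≡-Reasoning

  Σℤ-mul² : ∀ A B → Σℤ (λ g → mul G A B g ℤ.* mul G A B g) ≡ Σℤ (λ x → autocorr A x ℤ.* autocorr B x)
  Σℤ-mul² A B = begin
    Σℤ (λ g → mul G A B g ℤ.* mul G A B g)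
      ≡⟨ Σℤ-cong (λ g → Σℤ-*-Σℤ (a g) (a g)) ⟩
    Σℤ (λ g → Σℤ (λ h → Σℤ (λ k → a g h ℤ.* a g k)))
      ≡⟨ Σℤ-comm (λ g h → Σℤ (λ k → a g h ℤ.* a g k)) ⟩
    Σℤ (λ h → Σℤ (λ g → Σℤ (λ k → a g h ℤ.* a g k)))
      ≡⟨ Σℤ-cong (λ h → trans (Σℤ-comm (λ g k → a g h ℤ.* a g k)) (Σℤ-cong (pair h))) ⟩
    Σℤ (λ h → Σℤ (λ k → (A h ℤ.* A k) ℤ.* autocorr B (k ⁻¹ ∙ h)))
      ≡⟨ Σℤ-comm (λ h k → (A h ℤ.* A k) ℤ.* autocorr B (k ⁻¹ ∙ h)) ⟩
    Σℤ (λ k → Σℤ (λ h → (A h ℤ.* A k) ℤ.* autocorr B (k ⁻¹ ∙ h)))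
      ≡⟨ Σℤ-cong (λ k → trans (Σℤ-permute (translation k) _) (Σℤ-cong (shift k))) ⟩
    Σℤ (λ k → Σℤ (λ x → (A k ℤ.* A (x ∙ k)) ℤ.* autocorr B x))
      ≡⟨ Σℤ-comm (λ k x → (A k ℤ.* A (x ∙ k)) ℤ.* autocorr B x) ⟩
    Σℤ (λ x → Σℤ (λ k → (A k ℤ.* A (x ∙ k)) ℤ.* autocorr B x))
      ≡⟨ Σℤ-cong (λ x → Σℤ-*ʳ (autocorr B x) (λ k → A k ℤ.* A (x ∙ k))) ⟩
    Σℤ (λ x → autocorr A x ℤ.* autocorr B x)
      ∎
    where
    open ≡-Reasoning
    a : Fin m → Fin m → ℤ
    a g h = A h ℤ.* B (h ⁻¹ ∙ g)
    pair : ∀ h k → Σℤ (λ g → a g h ℤ.* a g k) ≡ (A h ℤ.* A k) ℤ.* autocorr B (k ⁻¹ ∙ h)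
    pair h k = begin
      Σℤ (λ g → a g h ℤ.* a g k)
        ≡⟨ Σℤ-cong (λ g → interchange (A h) (B (h ⁻¹ ∙ g)) (A k) (B (k ⁻¹ ∙ g))) ⟩
      Σℤ (λ g → (A h ℤ.* A k) ℤ.* (B (h ⁻¹ ∙ g) ℤ.* B (k ⁻¹ ∙ g)))
        ≡⟨ Σℤ-*ˡ (A h ℤ.* A k) (λ g → B (h ⁻¹ ∙ g) ℤ.* B (k ⁻¹ ∙ g)) ⟩
      (A h ℤ.* A k) ℤ.* Σℤ (λ g → B (h ⁻¹ ∙ g) ℤ.* B (k ⁻¹ ∙ g))
        ≡⟨ cong (ℤ._*_ (A h ℤ.* A k)) (Σℤ-permute (translation h) _) ⟩
      (A h ℤ.* A k) ℤ.* Σℤ (λ y → B (h ⁻¹ ∙ (h ∙ y)) ℤ.* B (k ⁻¹ ∙ (h ∙ y)))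
        ≡⟨ cong (ℤ._*_ (A h ℤ.* A k)) (Σℤ-cong (λ y →
             cong₂ ℤ._*_ (cong B (\\-leftDividesʳ h y)) (cong B (sym (assoc (k ⁻¹) h y))))) ⟩
      (A h ℤ.* A k) ℤ.* autocorr B (k ⁻¹ ∙ h)
        ∎
    shift : ∀ k x → (A (k ∙ x) ℤ.* A k) ℤ.* autocorr B (k ⁻¹ ∙ (k ∙ x)) ≡ (A k ℤ.* A (x ∙ k)) ℤ.* autocorr B x
    shift k x = cong₂ ℤ._*_ (trans (ℤP.*-comm (A (k ∙ x)) (A k)) (cong (λ z → A k ℤ.* A z) (comm k x)))
                            (cong (autocorr B) (\\-leftDividesʳ k x))

  mul-⟦⟧ : ∀ S S′ g → mul G ⟦ S ⟧ ⟦ S′ ⟧ g ≡ + ℕΣ.sum (λ h → 𝟙 (lookup S h) ℕ.* 𝟙 (lookup S′ (h ⁻¹ ∙ g)))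
  mul-⟦⟧ S S′ g = trans (Σℤ-cong product) (Σℤ-pos (λ h → 𝟙 (lookup S h) ℕ.* 𝟙 (lookup S′ (h ⁻¹ ∙ g))))
    where
    product : ∀ h → ⟦ S ⟧ h ℤ.* ⟦ S′ ⟧ (h ⁻¹ ∙ g) ≡ + (𝟙 (lookup S h) ℕ.* 𝟙 (lookup S′ (h ⁻¹ ∙ g)))
    product h = trans (cong₂ ℤ._*_ (⟦⟧≡𝟙 S h) (⟦⟧≡𝟙 S′ (h ⁻¹ ∙ g)))
                      (sym (ℤP.pos-* (𝟙 (lookup S h)) (𝟙 (lookup S′ (h ⁻¹ ∙ g)))))

  eGR-ε : eGR G ε ≡ 1ℤ
  eGR-ε with ε ≟ ε
  ... | yes _   = refl
  ... | no ε≢ε = contradiction refl ε≢ε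

-- Counting the support from the first two moments

pairs : ℕ → ℕ
pairs x = (x ∸ 1) * (x ∸ 2) / 2

2∣[1+n]*n : ∀ n → 2 ∣ suc n * n
2∣[1+n]*n zero    = 2 ∣0
2∣[1+n]*n (suc n) = subst (2 ∣_) (step n) (∣m∣n⇒∣m+n (2∣[1+n]*n n) (m∣m*n (suc n)))
  where
  step : ∀ n → suc n * n + 2 * suc n ≡ suc (suc n) * suc n
  step = ℕSolver.solve-∀

2*pairs : ∀ x → 2 * pairs x ≡ (x ∸ 1) * (x ∸ 2)
2*pairs zero          = refl
2*pairs (suc zero)    = refl
2*pairs (suc (suc y)) = m*[n/m]≡n (2∣[1+n]*n y)

positive+square : ∀ x → 2 * 𝟙 (0 <ᵇ x) + x * x ≡ 3 * x + 2 * pairs x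
positive+square zero    = refl
positive+square (suc y) = trans (expand y) (cong (_+_ (3 * suc y)) (sym (2*pairs (suc y))))
  where
  expand : ∀ y → 2 * 1 + suc y * suc y ≡ 3 * suc y + y * (y ∸ 1)
  expand zero    = refl
  expand (suc z) = ring z
    where
    ring : ∀ z → 2 * 1 + suc (suc z) * suc (suc z) ≡ 3 * suc (suc z) + suc z * z
    ring = ℕSolver.solve-∀

support-from-moments : ∀ ν γ A Q S₁ S₂ → + 2 ℤ.* A ℤ.+ S₂ ≡ + 3 ℤ.* S₁ ℤ.+ + 2 ℤ.* Q →
                       S₁ ≡ + 4 ℤ.* (ν ℤ.* ν) → S₂ ≡ + 12 ℤ.* (ν ℤ.* ν) ℤ.- + 8 ℤ.* ν ℤ.+ + 2 ℤ.* γ →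
                       A ≡ + 4 ℤ.* ν ℤ.- γ ℤ.+ Q
support-from-moments ν γ A Q S₁ S₂ moments S₁≡ S₂≡ =
  ℤP.*-cancelˡ-≡ (+ 2) A (+ 4 ℤ.* ν ℤ.- γ ℤ.+ Q) (begin
    + 2 ℤ.* A                          ≡⟨ isolate A S₂ ⟩
    (+ 2 ℤ.* A ℤ.+ S₂) ℤ.- S₂          ≡⟨ cong (ℤ._- S₂) moments ⟩
    (+ 3 ℤ.* S₁ ℤ.+ + 2 ℤ.* Q) ℤ.- S₂  ≡⟨ evaluate S₁ S₂ S₁≡ S₂≡ ⟩
    + 2 ℤ.* (+ 4 ℤ.* ν ℤ.- γ ℤ.+ Q)    ∎)
  where
  open ≡-Reasoning
  isolate : ∀ A S → + 2 ℤ.* A ≡ (+ 2 ℤ.* A ℤ.+ S) ℤ.- S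
  isolate = solve-∀
  evaluate : ∀ S₁ S₂ → S₁ ≡ + 4 ℤ.* (ν ℤ.* ν) → S₂ ≡ + 12 ℤ.* (ν ℤ.* ν) ℤ.- + 8 ℤ.* ν ℤ.+ + 2 ℤ.* γ →
             (+ 3 ℤ.* S₁ ℤ.+ + 2 ℤ.* Q) ℤ.- S₂ ≡ + 2 ℤ.* (+ 4 ℤ.* ν ℤ.- γ ℤ.+ Q)
  evaluate _ _ refl refl = polynomial ν γ Q
    where
    polynomial : ∀ ν γ Q → (+ 3 ℤ.* (+ 4 ℤ.* (ν ℤ.* ν)) ℤ.+ + 2 ℤ.* Q)
                           ℤ.- (+ 12 ℤ.* (ν ℤ.* ν) ℤ.- + 8 ℤ.* ν ℤ.+ + 2 ℤ.* γ)
                           ≡ + 2 ℤ.* (+ 4 ℤ.* ν ℤ.- γ ℤ.+ Q)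
    polynomial = solve-∀

module Setup (n : ℕ) (n≥1 : 1 ≤ n)
  (G : FinAbGroup (2 * (n * n) + 1)) (T : Subset (2 * (n * n) + 1))
  (∣T∣≡2n : ∣ T ∣ ≡ 2 * n)
  (T-symmetric : ∀ g → ⟦ T ⟧ g ≡ dil G (ℤ.- (+ 1)) ⟦ T ⟧ g)
  (T² : ∀ g → mul G ⟦ T ⟧ ⟦ T ⟧ g
              ≡ (+ 2) ℤ.* Hall G g ℤ.- dil G (+ 2) ⟦ T ⟧ g ℤ.+ (+ (2 * n ∸ 2)) ℤ.* eGR G g) where

  open FinAbGroup G
  open IsAbelianGroup isAbelianGroup using (identityˡ; identityʳ)

  M : ℕ
  M = 2 * (n * n) + 1

  ν K : ℤ
  ν = + n
  K = + (2 * n ∸ 2)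

  -- The group has odd order M, so squaring is invertible with inverse g ↦ g^((M+1)/2).
  squaring : Permutation′ M
  squaring = pow-permutation G 2 (n * n + 1) 1 (2[n²+1]≡1+M n)
    where
    2[n²+1]≡1+M : ∀ n → 2 * (n * n + 1) ≡ suc (1 * (2 * (n * n) + 1))
    2[n²+1]≡1+M = ℕSolver.solve-∀

  √ : Fin M → Fin M
  √ y = squaring ⟨$⟩ˡ y

  fourth : Permutation′ M
  fourth = squaring ∘ₚ squaring

  t u δ C : Fin M → ℤ
  t = ⟦ T ⟧
  u = ⟦ set4 G T ⟧
  δ = eGR G
  C = mul G t u

  t-inverse : ∀ h → t (h ⁻¹) ≡ t h
  t-inverse h = sym (trans (T-symmetric h)
    (dil-permutation G (ℤ.- (+ 1)) (inversion G) (λ h → cong _⁻¹ (sym (identityʳ h))) t h))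

  √-hom : Homomorphic G √
  √-hom = pow-∙ G (n * n + 1)

  u≡t∘√√ : ∀ y → u y ≡ t (√ (√ y))
  u≡t∘√√ = ⟦set4⟧ G fourth (λ h → pow-pow G 2 2 h) T

  autocorr-t : ∀ x → autocorr G t x ≡ + 2 ℤ.- t (√ x) ℤ.+ K ℤ.* δ x
  autocorr-t x = begin
    autocorr G t x
      ≡⟨ mul-self G t t-inverse x ⟨
    mul G t t x
      ≡⟨ T² x ⟩
    + 2 ℤ.- dil G (+ 2) t x ℤ.+ K ℤ.* δ x
      ≡⟨ cong (λ z → + 2 ℤ.- z ℤ.+ K ℤ.* δ x) (dil-permutation G (+ 2) squaring (λ _ → refl) t x) ⟩
    + 2 ℤ.- t (√ x) ℤ.+ K ℤ.* δ x
      ∎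
    where open ≡-Reasoning

  K≡2ν-2 : K ≡ + 2 ℤ.* ν ℤ.- + 2
  K≡2ν-2 = begin
    + (2 * n ∸ 2)   ≡⟨ ℤP.⊖-≥ (ℕP.*-monoʳ-≤ 2 n≥1) ⟨
    (2 * n) ℤ.⊖ 2   ≡⟨ ℤP.m-n≡m⊖n (2 * n) 2 ⟨
    + (2 * n) ℤ.- + 2 ≡⟨ cong (ℤ._- + 2) (ℤP.pos-* 2 n) ⟩
    + 2 ℤ.* ν ℤ.- + 2 ∎
    where open ≡-Reasoning

  Σt : Σℤ t ≡ + 2 ℤ.* ν
  Σt = trans (Σℤ-⟦⟧ T) (trans (cong (λ k → + k) ∣T∣≡2n) (ℤP.pos-* 2 n))

  -- Comparing |T| = (T T^(-1))(e) with the coefficient of e in 2H - T^(2) + (2n-2)e.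
  t-ε : t ε ≡ 0ℤ
  t-ε = cancel (t ε) (+ 2 ℤ.* ν) (begin
    + 2 ℤ.* ν
      ≡⟨ Σt ⟨
    Σℤ t
      ≡⟨ Σℤ-cong (λ h → trans (sym (⟦⟧-idem T h)) (cong (λ z → t h ℤ.* t z) (sym (identityˡ h)))) ⟩
    autocorr G t ε
      ≡⟨ autocorr-t ε ⟩
    + 2 ℤ.- t (√ ε) ℤ.+ K ℤ.* δ ε
      ≡⟨ cong₂ (λ a b → + 2 ℤ.- t a ℤ.+ b ℤ.* δ ε) (hom-ε G √-hom) K≡2ν-2 ⟩
    + 2 ℤ.- t ε ℤ.+ (+ 2 ℤ.* ν ℤ.- + 2) ℤ.* δ ε
      ≡⟨ cong (λ d → + 2 ℤ.- t ε ℤ.+ (+ 2 ℤ.* ν ℤ.- + 2) ℤ.* d) (eGR-ε G) ⟩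
    + 2 ℤ.- t ε ℤ.+ (+ 2 ℤ.* ν ℤ.- + 2) ℤ.* 1ℤ
      ∎)
    where
    open ≡-Reasoning
    cancel : ∀ a p → p ≡ + 2 ℤ.- a ℤ.+ (p ℤ.- + 2) ℤ.* 1ℤ → a ≡ 0ℤ
    cancel a p e = trans (rearrange a p) (trans (cong (λ z → ℤ.- (z ℤ.- p)) (sym e)) (cong ℤ.-_ (ℤP.+-inverseʳ p)))
      where
      rearrange : ∀ a p → a ≡ ℤ.- ((+ 2 ℤ.- a ℤ.+ (p ℤ.- + 2) ℤ.* 1ℤ) ℤ.- p)
      rearrange = solve-∀

  √√-hom : Homomorphic G (λ y → √ (√ y))
  √√-hom x y = trans (cong √ (√-hom x y)) (√-hom (√ x) (√ y))

  u-ε : u ε ≡ 0ℤ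
  u-ε = trans (u≡t∘√√ ε) (trans (cong t (hom-ε G √√-hom)) t-ε)

  Σu : Σℤ u ≡ + 2 ℤ.* ν
  Σu = trans (Σℤ-cong u≡t∘√√) (trans (sym (Σℤ-permute (flip fourth) t)) Σt)

  ΣC : Σℤ C ≡ (+ 2 ℤ.* ν) ℤ.* (+ 2 ℤ.* ν)
  ΣC = trans (Σℤ-mul G t u) (cong₂ ℤ._*_ Σt Σu)

  autocorr-u : ∀ x → autocorr G u x ≡ autocorr G t (√ (√ x))
  autocorr-u x = trans (Σℤ-cong (λ h → cong₂ ℤ._*_ (u≡t∘√√ h) (u≡t∘√√ (x ∙ h))))
                       (autocorr-automorphism G (flip fourth) √√-hom t x)

  autocorr-t-square : ∀ y → autocorr G t (pow G 2 y) ≡ + 2 ℤ.- t y ℤ.+ K ℤ.* δ y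
  autocorr-t-square y = trans (autocorr-t (pow G 2 y))
    (cong₂ (λ a d → + 2 ℤ.- t a ℤ.+ K ℤ.* d) (inverseˡ squaring) (eGR-automorphism G squaring (pow-∙ G 2) y))

  autocorr-t-√ : ∀ y → autocorr G t (√ y) ≡ + 2 ℤ.- u y ℤ.+ K ℤ.* δ y
  autocorr-t-√ y = trans (autocorr-t (√ y))
    (cong₂ (λ a d → + 2 ℤ.- a ℤ.+ K ℤ.* d) (sym (u≡t∘√√ y)) (eGR-automorphism G (flip squaring) √-hom y))

  L : ℤ
  L = + 4 ℤ.* K ℤ.+ K ℤ.* K

  E : Fin M → ℤ
  E y = + 4 ℤ.+ (ℤ.- + 2 ℤ.* t y ℤ.+ (ℤ.- + 2 ℤ.* u y ℤ.+ (t y ℤ.* u y ℤ.+ L ℤ.* δ y)))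

  -- The δ-terms survive only at e, where t and u vanish.
  expand : ∀ y → (+ 2 ℤ.- t y ℤ.+ K ℤ.* δ y) ℤ.* (+ 2 ℤ.- u y ℤ.+ K ℤ.* δ y) ≡ E y
  expand y with y ≟ ε
  ... | yes refl rewrite t-ε | u-ε = at-ε K
    where
    at-ε : ∀ k → (+ 2 ℤ.- 0ℤ ℤ.+ k ℤ.* 1ℤ) ℤ.* (+ 2 ℤ.- 0ℤ ℤ.+ k ℤ.* 1ℤ)
                 ≡ + 4 ℤ.+ (ℤ.- + 2 ℤ.* 0ℤ ℤ.+ (ℤ.- + 2 ℤ.* 0ℤ ℤ.+ (0ℤ ℤ.* 0ℤ ℤ.+ (+ 4 ℤ.* k ℤ.+ k ℤ.* k) ℤ.* 1ℤ)))
    at-ε = solve-∀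
  ... | no _ = away (t y) (u y) K
    where
    away : ∀ a b k → (+ 2 ℤ.- a ℤ.+ k ℤ.* 0ℤ) ℤ.* (+ 2 ℤ.- b ℤ.+ k ℤ.* 0ℤ)
                     ≡ + 4 ℤ.+ (ℤ.- + 2 ℤ.* a ℤ.+ (ℤ.- + 2 ℤ.* b ℤ.+ (a ℤ.* b ℤ.+ (+ 4 ℤ.* k ℤ.+ k ℤ.* k) ℤ.* 0ℤ)))
    away = solve-∀

  ΣE : Σℤ E ≡ + 12 ℤ.* (ν ℤ.* ν) ℤ.- + 8 ℤ.* ν ℤ.+ + ∣ T ∩ set4 G T ∣
  ΣE = begin
    Σℤ E
      ≡⟨ Σℤ-+ (λ _ → + 4) (λ y → e₁ y ℤ.+ (e₂ y ℤ.+ (e₃ y ℤ.+ e₄ y))) ⟩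
    Σℤ {M} (λ _ → + 4) ℤ.+ Σℤ (λ y → e₁ y ℤ.+ (e₂ y ℤ.+ (e₃ y ℤ.+ e₄ y)))
      ≡⟨ cong (ℤ._+_ (Σℤ {M} (λ _ → + 4)))
              (trans (Σℤ-+ e₁ (λ y → e₂ y ℤ.+ (e₃ y ℤ.+ e₄ y)))
                     (cong (ℤ._+_ (Σℤ e₁)) (trans (Σℤ-+ e₂ (λ y → e₃ y ℤ.+ e₄ y))
                                                 (cong (ℤ._+_ (Σℤ e₂)) (Σℤ-+ e₃ e₄))))) ⟩
    Σℤ {M} (λ _ → + 4) ℤ.+ (Σℤ e₁ ℤ.+ (Σℤ e₂ ℤ.+ (Σℤ e₃ ℤ.+ Σℤ e₄)))
      ≡⟨ cong₂ ℤ._+_ (Σℤ-const {M} (+ 4))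
           (cong₂ ℤ._+_ (trans (Σℤ-*ˡ (ℤ.- + 2) t) (cong (ℤ._*_ (ℤ.- + 2)) Σt))
             (cong₂ ℤ._+_ (trans (Σℤ-*ˡ (ℤ.- + 2) u) (cong (ℤ._*_ (ℤ.- + 2)) Σu))
               (cong₂ ℤ._+_ Σe₃ (trans (Σℤ-*ˡ L δ) (cong (ℤ._*_ L) (Σℤ-δ ε (λ _ → 1ℤ))))))) ⟩
    + M ℤ.* + 4 ℤ.+ (ℤ.- + 2 ℤ.* (+ 2 ℤ.* ν) ℤ.+ (ℤ.- + 2 ℤ.* (+ 2 ℤ.* ν) ℤ.+ (+ ∣ T ∩ set4 G T ∣ ℤ.+ L ℤ.* 1ℤ)))
      ≡⟨ evaluate (+ M) K (+ ∣ T ∩ set4 G T ∣) M≡2ν²+1 K≡2ν-2 ⟩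
    + 12 ℤ.* (ν ℤ.* ν) ℤ.- + 8 ℤ.* ν ℤ.+ + ∣ T ∩ set4 G T ∣
      ∎
    where
    open ≡-Reasoning
    e₁ e₂ e₃ e₄ : Fin M → ℤ
    e₁ y = ℤ.- + 2 ℤ.* t y
    e₂ y = ℤ.- + 2 ℤ.* u y
    e₃ y = t y ℤ.* u y
    e₄ y = L ℤ.* δ y
    Σe₃ : Σℤ e₃ ≡ + ∣ T ∩ set4 G T ∣
    Σe₃ = trans (Σℤ-cong (λ y → sym (⟦∩⟧ T (set4 G T) y))) (Σℤ-⟦⟧ (T ∩ set4 G T))
    M≡2ν²+1 : + M ≡ + 2 ℤ.* (ν ℤ.* ν) ℤ.+ 1ℤ
    M≡2ν²+1 = trans (ℤP.pos-+ (2 * (n * n)) 1)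
                    (cong (ℤ._+ 1ℤ) (trans (ℤP.pos-* 2 (n * n)) (cong (ℤ._*_ (+ 2)) (ℤP.pos-* n n))))
    evaluate : ∀ μ k x → μ ≡ + 2 ℤ.* (ν ℤ.* ν) ℤ.+ 1ℤ → k ≡ + 2 ℤ.* ν ℤ.- + 2 →
               μ ℤ.* + 4 ℤ.+ (ℤ.- + 2 ℤ.* (+ 2 ℤ.* ν)
                 ℤ.+ (ℤ.- + 2 ℤ.* (+ 2 ℤ.* ν) ℤ.+ (x ℤ.+ (+ 4 ℤ.* k ℤ.+ k ℤ.* k) ℤ.* 1ℤ)))
               ≡ + 12 ℤ.* (ν ℤ.* ν) ℤ.- + 8 ℤ.* ν ℤ.+ x
    evaluate _ _ x refl refl = polynomial ν x
      where
      polynomial : ∀ ν x →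
        (+ 2 ℤ.* (ν ℤ.* ν) ℤ.+ 1ℤ) ℤ.* + 4 ℤ.+ (ℤ.- + 2 ℤ.* (+ 2 ℤ.* ν) ℤ.+ (ℤ.- + 2 ℤ.* (+ 2 ℤ.* ν)
          ℤ.+ (x ℤ.+ (+ 4 ℤ.* (+ 2 ℤ.* ν ℤ.- + 2) ℤ.+ (+ 2 ℤ.* ν ℤ.- + 2) ℤ.* (+ 2 ℤ.* ν ℤ.- + 2)) ℤ.* 1ℤ)))
        ≡ + 12 ℤ.* (ν ℤ.* ν) ℤ.- + 8 ℤ.* ν ℤ.+ x
      polynomial = solve-∀

  ΣC² : Σℤ (λ g → C g ℤ.* C g) ≡ + 12 ℤ.* (ν ℤ.* ν) ℤ.- + 8 ℤ.* ν ℤ.+ + ∣ T ∩ set4 G T ∣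
  ΣC² = begin
    Σℤ (λ g → C g ℤ.* C g)
      ≡⟨ Σℤ-mul² G t u ⟩
    Σℤ (λ x → autocorr G t x ℤ.* autocorr G u x)
      ≡⟨ Σℤ-cong (λ x → cong (ℤ._*_ (autocorr G t x)) (autocorr-u x)) ⟩
    Σℤ (λ x → autocorr G t x ℤ.* autocorr G t (√ (√ x)))
      ≡⟨ Σℤ-permute squaring (λ x → autocorr G t x ℤ.* autocorr G t (√ (√ x))) ⟩
    Σℤ (λ y → autocorr G t (pow G 2 y) ℤ.* autocorr G t (√ (√ (pow G 2 y))))
      ≡⟨ Σℤ-cong (λ y → cong₂ ℤ._*_ (autocorr-t-square y)
                                   (trans (cong (autocorr G t ∘ √) (inverseˡ squaring)) (autocorr-t-√ y))) ⟩
    Σℤ (λ y → (+ 2 ℤ.- t y ℤ.+ K ℤ.* δ y) ℤ.* (+ 2 ℤ.- u y ℤ.+ K ℤ.* δ y))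
      ≡⟨ Σℤ-cong expand ⟩
    Σℤ E
      ≡⟨ ΣE ⟩
    + 12 ℤ.* (ν ℤ.* ν) ℤ.- + 8 ℤ.* ν ℤ.+ + ∣ T ∩ set4 G T ∣
      ∎
    where open ≡-Reasoning

  c : Fin M → ℕ
  c g = ℕΣ.sum (λ h → 𝟙 (lookup T h) * 𝟙 (lookup (set4 G T) (h ⁻¹ ∙ g)))

  C≡c : ∀ g → C g ≡ + c g
  C≡c = mul-⟦⟧ G T (set4 G T)

  Σc : ℕΣ.sum c ≡ 4 * (n * n)
  Σc = ℤP.+-injective (begin
    + ℕΣ.sum c                       ≡⟨ Σℤ-pos c ⟨
    Σℤ (λ g → + c g)                 ≡⟨ Σℤ-cong (sym ∘ C≡c) ⟩
    Σℤ C                             ≡⟨ ΣC ⟩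
    (+ 2 ℤ.* ν) ℤ.* (+ 2 ℤ.* ν)      ≡⟨ square-double ν ⟩
    + 4 ℤ.* (ν ℤ.* ν)                ≡⟨ cong (ℤ._*_ (+ 4)) (ℤP.pos-* n n) ⟨
    + 4 ℤ.* + (n * n)                ≡⟨ ℤP.pos-* 4 (n * n) ⟨
    + (4 * (n * n))                  ∎)
    where
    open ≡-Reasoning
    square-double : ∀ ν → (+ 2 ℤ.* ν) ℤ.* (+ 2 ℤ.* ν) ≡ + 4 ℤ.* (ν ℤ.* ν)
    square-double = solve-∀

  Σc² : + ℕΣ.sum (λ g → c g * c g) ≡ + 12 ℤ.* (ν ℤ.* ν) ℤ.- + 8 ℤ.* ν ℤ.+ + ∣ T ∩ set4 G T ∣
  Σc² = begin
    + ℕΣ.sum (λ g → c g * c g)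
      ≡⟨ Σℤ-pos (λ g → c g * c g) ⟨
    Σℤ (λ g → + (c g * c g))
      ≡⟨ Σℤ-cong (λ g → trans (ℤP.pos-* (c g) (c g)) (sym (cong₂ ℤ._*_ (C≡c g) (C≡c g)))) ⟩
    Σℤ (λ g → C g ℤ.* C g)
      ≡⟨ ΣC² ⟩
    + 12 ℤ.* (ν ℤ.* ν) ℤ.- + 8 ℤ.* ν ℤ.+ + ∣ T ∩ set4 G T ∣ ∎
    where open ≡-Reasoning

  module Levels (N : ℕ) (C≤N : ∀ g → C g ℤ.≤ + N) where

    Y : ℕ → Subset M
    Y = Ylevel C

    c≤N : ∀ g → c g ≤ N
    c≤N g = ℤP.drop‿+≤+ (subst (ℤ._≤ + N) (C≡c g) (C≤N g))

    c<N+1 : ∀ g → c g < N + 1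
    c<N+1 g = ℕP.≤-trans (s≤s (c≤N g)) (ℕP.≤-reflexive (ℕP.+-comm 1 N))

    c<N∸2+3 : ∀ g → c g < N ∸ 2 + 3
    c<N∸2+3 g = ℕP.≤-trans (s≤s (ℕP.≤-trans (c≤N g) (ℕP.m≤n+m∸n N 2)))
                           (ℕP.≤-reflexive (ℕP.+-comm 3 (N ∸ 2)))

    Σ∣Y∣ : sum (map (λ i → ∣ Y i ∣) (upTo (N + 1))) ≡ M
    Σ∣Y∣ = begin
      sum (map (λ i → ∣ Y i ∣) (upTo (N + 1)))
        ≡⟨ cong sum (map-cong (λ i → sym (ℕP.*-identityˡ ∣ Y i ∣)) (upTo (N + 1))) ⟩
      sum (map (λ i → 1 * ∣ Y i ∣) (upTo (N + 1)))
        ≡⟨ sum-levels C c C≡c (λ _ → 1) (N + 1) c<N+1 ⟩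
      ℕΣ.sum {M} (λ _ → 1)
        ≡⟨ trans (ℕΣ-const {M} 1) (ℕP.*-identityʳ M) ⟩
      M
        ∎
      where open ≡-Reasoning

    Σi∣Y∣ : sum (map (λ j → (j + 1) * ∣ Y (j + 1) ∣) (upTo N)) ≡ 4 * (n * n)
    Σi∣Y∣ = begin
      sum (map (λ j → (j + 1) * ∣ Y (j + 1) ∣) (upTo N))
        ≡⟨ sum-upTo-offset (λ i → i * ∣ Y i ∣) 1 N (λ { zero _ → refl ; (suc _) (s≤s ()) }) ⟩
      sum (map (λ i → i * ∣ Y i ∣) (upTo (N + 1)))
        ≡⟨ sum-levels C c C≡c (λ i → i) (N + 1) c<N+1 ⟩
      ℕΣ.sum c
        ≡⟨ Σc ⟩
      4 * (n * n)
        ∎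
      where open ≡-Reasoning

    A Q : ℕ
    A = ℕΣ.sum (λ g → 𝟙 (0 <ᵇ c g))
    Q = ℕΣ.sum (λ g → pairs (c g))

    Σ∣Y₊∣≡A : sum (map (λ j → ∣ Y (j + 1) ∣) (upTo N)) ≡ A
    Σ∣Y₊∣≡A = begin
      sum (map (λ j → ∣ Y (j + 1) ∣) (upTo N))
        ≡⟨ cong sum (map-cong weight (upTo N)) ⟨
      sum (map (λ j → 𝟙 (0 <ᵇ (j + 1)) * ∣ Y (j + 1) ∣) (upTo N))
        ≡⟨ sum-upTo-offset (λ i → 𝟙 (0 <ᵇ i) * ∣ Y i ∣) 1 N (λ { zero _ → refl ; (suc _) (s≤s ()) }) ⟩
      sum (map (λ i → 𝟙 (0 <ᵇ i) * ∣ Y i ∣) (upTo (N + 1)))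
        ≡⟨ sum-levels C c C≡c (λ i → 𝟙 (0 <ᵇ i)) (N + 1) c<N+1 ⟩
      A
        ∎
      where
      open ≡-Reasoning
      weight : ∀ j → 𝟙 (0 <ᵇ (j + 1)) * ∣ Y (j + 1) ∣ ≡ ∣ Y (j + 1) ∣
      weight j rewrite ℕP.+-comm j 1 = ℕP.*-identityˡ ∣ Y (suc j) ∣

    ΣpairsY≡Q : sum (map (λ j → pairs (j + 3) * ∣ Y (j + 3) ∣) (upTo (N ∸ 2))) ≡ Q
    ΣpairsY≡Q = trans (sum-upTo-offset (λ i → pairs i * ∣ Y i ∣) 3 (N ∸ 2) below3)
                      (sum-levels C c C≡c pairs (N ∸ 2 + 3) c<N∸2+3)
      where
      below3 : ∀ i → i < 3 → pairs i * ∣ Y i ∣ ≡ 0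
      below3 0 _ = refl
      below3 1 _ = refl
      below3 2 _ = refl
      below3 (suc (suc (suc _))) (s≤s (s≤s (s≤s ())))

    double-count : 2 * A + ℕΣ.sum (λ g → c g * c g) ≡ 3 * ℕΣ.sum c + 2 * Q
    double-count = begin
      2 * A + ℕΣ.sum (λ g → c g * c g)
        ≡⟨ cong (_+ ℕΣ.sum (λ g → c g * c g)) (ℕΣ.*-distribˡ-sum 2 (λ g → 𝟙 (0 <ᵇ c g))) ⟩
      ℕΣ.sum (λ g → 2 * 𝟙 (0 <ᵇ c g)) + ℕΣ.sum (λ g → c g * c g)
        ≡⟨ ℕΣ.∑-distrib-+ (λ g → 2 * 𝟙 (0 <ᵇ c g)) (λ g → c g * c g) ⟨
      ℕΣ.sum (λ g → 2 * 𝟙 (0 <ᵇ c g) + c g * c g)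
        ≡⟨ ℕΣ.sum-cong-≗ (λ g → positive+square (c g)) ⟩
      ℕΣ.sum (λ g → 3 * c g + 2 * pairs (c g))
        ≡⟨ ℕΣ.∑-distrib-+ (λ g → 3 * c g) (λ g → 2 * pairs (c g)) ⟩
      ℕΣ.sum (λ g → 3 * c g) + ℕΣ.sum (λ g → 2 * pairs (c g))
        ≡⟨ cong₂ _+_ (ℕΣ.*-distribˡ-sum 3 c) (ℕΣ.*-distribˡ-sum 2 (λ g → pairs (c g))) ⟨
      3 * ℕΣ.sum c + 2 * Q
        ∎
      where open ≡-Reasoning

    Σ∣Y₊∣ : (γ : ℕ) → 2 * γ ≡ ∣ T ∩ set4 G T ∣ →
            + sum (map (λ j → ∣ Y (j + 1) ∣) (upTo N))
            ≡ + (4 * n) ℤ.- + γ ℤ.+ + sum (map (λ j → pairs (j + 3) * ∣ Y (j + 3) ∣) (upTo (N ∸ 2)))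
    Σ∣Y₊∣ γ 2γ≡∣T∩T⁽⁴⁾∣ = begin
      + sum (map (λ j → ∣ Y (j + 1) ∣) (upTo N))
        ≡⟨ cong (λ k → + k) Σ∣Y₊∣≡A ⟩
      + A
        ≡⟨ support-from-moments ν (+ γ) (+ A) (+ Q) (+ ℕΣ.sum c) (+ ℕΣ.sum (λ g → c g * c g))
                                sums Σc⁺ Σc²⁺ ⟩
      + 4 ℤ.* ν ℤ.- + γ ℤ.+ + Q
        ≡⟨ cong₂ (λ a q → a ℤ.- + γ ℤ.+ + q) (ℤP.pos-* 4 n) ΣpairsY≡Q ⟨
      + (4 * n) ℤ.- + γ ℤ.+ + sum (map (λ j → pairs (j + 3) * ∣ Y (j + 3) ∣) (upTo (N ∸ 2)))
        ∎
      where
      open ≡-Reasoning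
      sums : + 2 ℤ.* + A ℤ.+ + ℕΣ.sum (λ g → c g * c g) ≡ + 3 ℤ.* + ℕΣ.sum c ℤ.+ + 2 ℤ.* + Q
      sums = begin
        + 2 ℤ.* + A ℤ.+ + ℕΣ.sum (λ g → c g * c g)
          ≡⟨ cong (ℤ._+ + ℕΣ.sum (λ g → c g * c g)) (ℤP.pos-* 2 A) ⟨
        + (2 * A) ℤ.+ + ℕΣ.sum (λ g → c g * c g)
          ≡⟨ ℤP.pos-+ (2 * A) _ ⟨
        + (2 * A + ℕΣ.sum (λ g → c g * c g))
          ≡⟨ cong (λ k → + k) double-count ⟩
        + (3 * ℕΣ.sum c + 2 * Q)
          ≡⟨ ℤP.pos-+ (3 * ℕΣ.sum c) (2 * Q) ⟩
        + (3 * ℕΣ.sum c) ℤ.+ + (2 * Q)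
          ≡⟨ cong₂ ℤ._+_ (ℤP.pos-* 3 (ℕΣ.sum c)) (ℤP.pos-* 2 Q) ⟩
        + 3 ℤ.* + ℕΣ.sum c ℤ.+ + 2 ℤ.* + Q
          ∎
      Σc⁺ : + ℕΣ.sum c ≡ + 4 ℤ.* (ν ℤ.* ν)
      Σc⁺ = trans (cong (λ k → + k) Σc) (trans (ℤP.pos-* 4 (n * n)) (cong (ℤ._*_ (+ 4)) (ℤP.pos-* n n)))
      Σc²⁺ : + ℕΣ.sum (λ g → c g * c g) ≡ + 12 ℤ.* (ν ℤ.* ν) ℤ.- + 8 ℤ.* ν ℤ.+ + 2 ℤ.* + γ
      Σc²⁺ = trans Σc² (cong (λ k → + 12 ℤ.* (ν ℤ.* ν) ℤ.- + 8 ℤ.* ν ℤ.+ k)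
                             (trans (cong (λ k → + k) (sym 2γ≡∣T∩T⁽⁴⁾∣)) (ℤP.pos-* 2 γ)))

lemma8 : (n : ℕ) → 3 ≤ n →
    (G : FinAbGroup (2 * (n * n) + 1)) →
    (T : Subset (2 * (n * n) + 1)) →
    ∣ T ∣ ≡ 2 * n →
    (∀ g → ⟦ T ⟧ g ≡ dil G (ℤ.- (+ 1)) ⟦ T ⟧ g) →
    (∀ g → mul G ⟦ T ⟧ ⟦ T ⟧ g
           ≡ (+ 2) ℤ.* Hall G g ℤ.- dil G (+ 2) ⟦ T ⟧ g ℤ.+ (+ (2 * n ∸ 2)) ℤ.* eGR G g) →
    (N : ℕ) →
    (∀ g → mul G ⟦ T ⟧ ⟦ set4 G T ⟧ g ℤ.≤ + N) →
    ∃ (λ g → mul G ⟦ T ⟧ ⟦ set4 G T ⟧ g ≡ + N) →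
    (γ : ℕ) → 2 * γ ≡ ∣ T ∩ set4 G T ∣ →
    (sum (map (λ i → ∣ Ylevel (mul G ⟦ T ⟧ ⟦ set4 G T ⟧) i ∣) (upTo (N + 1)))
       ≡ 2 * (n * n) + 1)
    × (sum (map (λ j → (j + 1) * ∣ Ylevel (mul G ⟦ T ⟧ ⟦ set4 G T ⟧) (j + 1) ∣) (upTo N))
       ≡ 4 * (n * n))
    × (+ sum (map (λ j → ∣ Ylevel (mul G ⟦ T ⟧ ⟦ set4 G T ⟧) (j + 1) ∣) (upTo N))
       ≡ + (4 * n) ℤ.- + γ
         ℤ.+ + sum (map (λ j → (((j + 3) ∸ 1) * ((j + 3) ∸ 2) / 2)
                               * ∣ Ylevel (mul G ⟦ T ⟧ ⟦ set4 G T ⟧) (j + 3) ∣)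
                        (upTo (N ∸ 2))))
lemma8 n 3≤n G T ∣T∣≡2n T-symmetric T² N C≤N _ γ 2γ≡∣T∩T⁽⁴⁾∣ = Σ∣Y∣ , Σi∣Y∣ , Σ∣Y₊∣ γ 2γ≡∣T∩T⁽⁴⁾∣
  where
  open Setup n (ℕP.≤-trans (s≤s z≤n) 3≤n) G T ∣T∣≡2n T-symmetric T²
  open Levels N C≤N
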